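{- Let $F$ be a non-Archimedean local field with ring of integers $\mathcal{O}_F$ and uniformizer $\varpi$, let $D=M_2(F)$ and $\mathcal{O}_D=M_2(\mathcal{O}_F)$, and let $\eta\in\mathcal{O}_D\setminus\varpi\mathcal{O}_D$. Let $\eta^\dagger\frac{\mathcal{O}_D}{\mathrm{nrd}(\eta)\mathcal{O}_D}\eta$ denote the image of $\{\eta^\dagger A\eta:A\in\mathcal{O}_D\}$ in $\mathcal{O}_D/\mathrm{nrd}(\eta)\mathcal{O}_D$. Then there is an isomorphism of $\mathcal{O}_F$-modules $$\eta^\dagger\frac{\mathcal{O}_D}{\mathrm{nrd}(\eta)\mathcal{O}_D}\eta\cong\mathcal{O}_F/\mathrm{nrd}(\eta)\mathcal{O}_F.$$ In particular it is a cyclic $\mathcal{O}_F$-module, generated by the image of some $N\in\eta^\dagger\mathcal{O}_D\eta$.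
   Context: $\eta^\dagger$ is the adjugate of $\eta$ (the standard involution), and $\mathrm{nrd}=\det$. -}

module Defs where

open import Level using (Level; _⊔_) renaming (suc to lsuc)
open import Algebra.Bundles using (CommutativeRing)
open import Data.Nat using (ℕ; _≥_)
open import Data.Fin using (Fin)
open import Data.Integer as ℤ using (ℤ)
open import Data.Unit.Polymorphic using (⊤)
open import Data.Empty.Polymorphic using (⊥)
open import Data.Product using (Σ; ∃; ∃-syntax; _×_; _,_)
open import Relation.Nullary using (¬_)
open import Relation.Binary.PropositionalEquality using (_≡_)

data ℤ∞ : Set where
  fin : ℤ → ℤ∞
  ∞   : ℤ∞

_≤∞_ : ℤ∞ → ℤ∞ → Set
fin a ≤∞ fin b = a ℤ.≤ b
fin a ≤∞ ∞     = ⊤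
∞     ≤∞ fin b = ⊥
∞     ≤∞ ∞     = ⊤

_+∞_ : ℤ∞ → ℤ∞ → ℤ∞
fin a +∞ fin b = fin (a ℤ.+ b)
fin a +∞ ∞     = ∞
∞     +∞ _     = ∞

_⊓∞_ : ℤ∞ → ℤ∞ → ℤ∞
fin a ⊓∞ fin b = fin (a ℤ.⊓ b)
fin a ⊓∞ ∞     = fin a
∞     ⊓∞ y     = y

module _ {c ℓ : Level} (R : CommutativeRing c ℓ) where
  open CommutativeRing R

  IsField : Set (c ⊔ ℓ)
  IsField = (¬ (1# ≈ 0#)) × (∀ x → ¬ (x ≈ 0#) → ∃[ y ] (x * y ≈ 1#))

  record NALocalField : Set (lsuc (c ⊔ ℓ)) where
    field
      isField  : IsField
      v        : Carrier → ℤ∞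
      ϖ        : Carrier
      v-cong   : ∀ {x y} → x ≈ y → v x ≡ v y
      v-zero   : ∀ x → (v x ≡ ∞ → x ≈ 0#) × (x ≈ 0# → v x ≡ ∞)
      v-mul    : ∀ x y → v (x * y) ≡ v x +∞ v y
      v-add    : ∀ x y → (v x ⊓∞ v y) ≤∞ v (x + y)
      v-ϖ      : v ϖ ≡ fin (ℤ.+ 1)
      complete : (s : ℕ → Carrier) →
                 (∀ (k : ℤ) → ∃[ N ] ∀ m n → m ≥ N → n ≥ N →
                     fin k ≤∞ v (s m + - s n)) →
                 ∃[ L ] ∀ (k : ℤ) → ∃[ N ] ∀ n → n ≥ N →
                     fin k ≤∞ v (s n + - L)
      finiteResidue : ∃[ n ] Σ (Fin n → Carrier) λ r →
                 (∀ i → fin (ℤ.+ 0) ≤∞ v (r i)) ×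
                 (∀ x → fin (ℤ.+ 0) ≤∞ v x →
                     ∃[ i ] fin (ℤ.+ 1) ≤∞ v (x + - r i))

  record M2 : Set c where
    constructor mat
    field
      a b c' d : Carrier

  _*M_ : M2 → M2 → M2
  mat a b c' d *M mat a' b' c'' d' =
    mat (a * a' + b * c'') (a * b' + b * d')
        (c' * a' + d * c'') (c' * b' + d * d')

  _+M_ : M2 → M2 → M2
  mat a b c' d +M mat a' b' c'' d' = mat (a + a') (b + b') (c' + c'') (d + d')

  -M_ : M2 → M2
  -M mat a b c' d = mat (- a) (- b) (- c') (- d)

  _·M_ : Carrier → M2 → M2
  x ·M mat a b c' d = mat (x * a) (x * b) (x * c') (x * d)

  -- standard involution η ↦ η† (the adjugate)
  adj : M2 → M2
  adj (mat a b c' d) = mat d (- b) (- c') a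

  nrd : M2 → Carrier
  nrd (mat a b c' d) = a * d + - (b * c')

  AllM : (Carrier → Set (c ⊔ ℓ)) → M2 → Set (c ⊔ ℓ)
  AllM P (mat a b c' d) = P a × P b × P c' × P d

module LF {c ℓ : Level} {R : CommutativeRing c ℓ} (L : NALocalField R) where
  open CommutativeRing R
  open NALocalField L

  Integral : Carrier → Set (c ⊔ ℓ)
  Integral x = ⊤ {c ⊔ ℓ} × (fin (ℤ.+ 0) ≤∞ v x)

  _∣O_ : Carrier → Carrier → Set (c ⊔ ℓ)
  t ∣O x = ∃[ y ] (Integral y × x ≈ t * y)

  IntegralM : M2 R → Set (c ⊔ ℓ)
  IntegralM = AllM R Integral

  _∣OD_ : Carrier → M2 R → Set (c ⊔ ℓ)
  t ∣OD M = AllM R (t ∣O_) M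

  -- The O_F-module  η† (O_D / nrd(η) O_D) η : its elements are the classes of
  -- η† A η for A ∈ O_D; an element is represented by such an A, and two
  -- representatives are equal iff η† A η − η† A' η ∈ nrd(η) O_D.
  -- Module operations: [η†Aη] + [η†A'η] = [η†(A+A')η],  x·[η†Aη] = [η†(xA)η].
  conj : M2 R → M2 R → M2 R
  conj η A = _*M_ R (_*M_ R (adj R η) A) η

  _≈[_]S_ : M2 R → M2 R → M2 R → Set (c ⊔ ℓ)
  A ≈[ η ]S A' = nrd R η ∣OD (_+M_ R (conj η A) (-M_ R (conj η A')))

  -- The O_F-module O_F / t O_F : elements represented by x ∈ O_F,
  -- x ~ y iff x − y ∈ t O_F.
  _≈[_]Q_ : Carrier → Carrier → Carrier → Set (c ⊔ ℓ)
  x ≈[ t ]Q y = t ∣O (x + - y)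

  record ModIso (η : M2 R) : Set (c ⊔ ℓ) where
    field
      to        : (A : M2 R) → IntegralM A → Carrier
      to-int    : ∀ A iA → Integral (to A iA)
      from      : (x : Carrier) → Integral x → M2 R
      from-int  : ∀ x ix → IntegralM (from x ix)
      to-cong   : ∀ A iA B iB → A ≈[ η ]S B → to A iA ≈[ nrd R η ]Q to B iB
      from-cong : ∀ x ix y iy → x ≈[ nrd R η ]Q y →
                  from x ix ≈[ η ]S from y iy
      from∘to   : ∀ A iA → from (to A iA) (to-int A iA) ≈[ η ]S A
      to∘from   : ∀ x ix → to (from x ix) (from-int x ix) ≈[ nrd R η ]Q x
      -- O_F-linearity of `to` (linearity of `from` follows)
      to-+      : ∀ A iA B iB iAB →
                  to (_+M_ R A B) iAB ≈[ nrd R η ]Q (to A iA + to B iB)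
      to-·      : ∀ x (ix : Integral x) A iA ixA →
                  to (_·M_ R x A) ixA ≈[ nrd R η ]Q (x * to A iA)

  Cyclic : M2 R → Set (c ⊔ ℓ)
  Cyclic η = ∃[ A₀ ] (IntegralM A₀ ×
               (∀ A → IntegralM A → ∃[ x ] (Integral x × A ≈[ η ]S (_·M_ R x A₀))))

{-# OPTIONS --safe #-}
module Submission where

-- Write δ = nrd η. A primitive η has a unit entry, so there are integral vectors w, z with
-- wᵀ η z = 1. For 2×2 matrices P X P + det P · adj X = tr (P X) · P, hence modulo δ we have
-- η† ≡ η† X η† and η ≡ η Z η for the rank-one matrices X = (J w)(J z)ᵀ and Z = z wᵀ, where
-- J (x , y) = (- y , x), because tr (η† X) = tr (η Z) = wᵀ η z = 1. Consequently
-- η† A η ≡ η† X η† A η Z η = φ (η† A η) · N  with  φ M = (J z)ᵀ M z  and  N = η† (J w) wᵀ η,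
-- so the module is generated by the class of N, and φ N = 1 makes φ an inverse of x ↦ x N.

open import Level using (Level; _⊔_; 0ℓ)
open import Algebra.Bundles using (CommutativeRing; AbelianGroup)
open import Algebra.Solver.Ring.AlmostCommutativeRing
  using (fromCommutativeRing; _-Raw-AlmostCommutative⟶_)
open import Data.Nat as ℕ using (ℕ; zero; suc; z≤n)
import Data.Nat.Properties as ℕ
open import Data.Integer as ℤ using (ℤ; +_; -[1+_]; _⊖_; sign; ∣_∣)
import Data.Integer.Properties as ℤ
open import Data.Sign as Sign using (Sign)
open import Data.Fin using (Fin; zero; suc; #_)
open import Data.Vec using (_∷_; [])
open import Data.Maybe using (Maybe; map)
open import Data.Product using (_×_; _,_; proj₁; proj₂; ∃-syntax)
open import Data.Sum using (_⊎_; inj₁; inj₂)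
open import Data.Unit.Polymorphic using (tt)
open import Data.Empty using (⊥-elim)
open import Function using (case_of_)
open import Relation.Nullary using (¬_)
open import Relation.Binary.Consequences using (dec⇒weaklyDec)
open import Relation.Binary.PropositionalEquality as ≡ using (_≡_)
open import Defs hiding (_*M_; _+M_; -M_; _·M_; adj; nrd)
import Defs as D

-- The ring solver cancels terms only when it can decide equality of coefficients, which R
-- need not allow; so the coefficients are integers, mapped into R by ι.
module IntegerCoefficients {c ℓ : Level} (R : CommutativeRing c ℓ) where
  open CommutativeRing R
  open import Algebra.Properties.Ring ring using (-0#≈0#; -1*x≈-x; -‿involutive)
  open import Algebra.Properties.AbelianGroup +-abelianGroup using (⁻¹-∙-comm)
  open import Algebra.Properties.CommutativeSemigroup +-commutativeSemigroup
    using () renaming (interchange to +-interchange)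
  open import Algebra.Properties.CommutativeSemigroup *-commutativeSemigroup
    using (interchange)
  open import Algebra.Properties.Semiring.Mult semiring using (×-homo-+; ×1-homo-*)
    renaming (_×_ to _×ᴿ_)
  open import Relation.Binary.Reasoning.Setoid setoid

  ι : ℤ → Carrier
  ι (+ n)    = n ×ᴿ 1#
  ι -[1+ n ] = - (suc n ×ᴿ 1#)

  ι-⊖ : ∀ m n → ι (m ⊖ n) ≈ m ×ᴿ 1# + - (n ×ᴿ 1#)
  ι-⊖ m       zero    = sym (trans (+-congˡ -0#≈0#) (+-identityʳ _))
  ι-⊖ zero    (suc n) = sym (+-identityˡ _)
  ι-⊖ (suc m) (suc n) = begin
    ι (suc m ⊖ suc n)                    ≡⟨ ≡.cong ι (ℤ.[1+m]⊖[1+n]≡m⊖n m n) ⟩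
    ι (m ⊖ n)                            ≈⟨ ι-⊖ m n ⟩
    m ×ᴿ 1# + - (n ×ᴿ 1#)                  ≈⟨ +-identityˡ _ ⟨
    0# + (m ×ᴿ 1# + - (n ×ᴿ 1#))           ≈⟨ +-congʳ (-‿inverseʳ 1#) ⟨
    (1# + - 1#) + (m ×ᴿ 1# + - (n ×ᴿ 1#))  ≈⟨ +-interchange _ _ _ _ ⟩
    (1# + m ×ᴿ 1#) + (- 1# + - (n ×ᴿ 1#))  ≈⟨ +-congˡ (⁻¹-∙-comm 1# (n ×ᴿ 1#)) ⟩
    suc m ×ᴿ 1# + - (suc n ×ᴿ 1#)          ∎

  ι-+ : ∀ i j → ι (i ℤ.+ j) ≈ ι i + ι j
  ι-+ (+ m)    (+ n)    = ×-homo-+ 1# m n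
  ι-+ (+ m)    -[1+ n ] = ι-⊖ m (suc n)
  ι-+ -[1+ m ] (+ n)    = trans (ι-⊖ n (suc m)) (+-comm _ _)
  ι-+ -[1+ m ] -[1+ n ] = begin
    - (suc (suc (m ℕ.+ n)) ×ᴿ 1#)     ≡⟨ ≡.cong (λ k → - (suc k ×ᴿ 1#)) (ℕ.+-suc m n) ⟨
    - ((suc m ℕ.+ suc n) ×ᴿ 1#)       ≈⟨ -‿cong (×-homo-+ 1# (suc m) (suc n)) ⟩
    - (suc m ×ᴿ 1# + suc n ×ᴿ 1#)      ≈⟨ ⁻¹-∙-comm _ _ ⟨
    - (suc m ×ᴿ 1#) + - (suc n ×ᴿ 1#)  ∎

  σ : Sign → Carrier
  σ Sign.+ = 1#
  σ Sign.- = - 1#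

  σ-* : ∀ s t → σ (s Sign.* t) ≈ σ s * σ t
  σ-* Sign.+ t      = sym (*-identityˡ _)
  σ-* Sign.- Sign.+ = sym (*-identityʳ _)
  σ-* Sign.- Sign.- = sym (trans (-1*x≈-x _) (-‿involutive _))

  ι-◃ : ∀ s n → ι (s ℤ.◃ n) ≈ σ s * (n ×ᴿ 1#)
  ι-◃ s      zero    = sym (zeroʳ _)
  ι-◃ Sign.+ (suc n) = sym (*-identityˡ _)
  ι-◃ Sign.- (suc n) = sym (-1*x≈-x _)

  ι-sign-abs : ∀ i → ι i ≈ σ (sign i) * (∣ i ∣ ×ᴿ 1#)
  ι-sign-abs i = trans (reflexive (≡.cong ι (≡.sym (ℤ.◃-inverse i)))) (ι-◃ (sign i) ∣ i ∣)

  ι-* : ∀ i j → ι (i ℤ.* j) ≈ ι i * ι j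
  ι-* i j = begin
    ι (i ℤ.* j)                                            ≈⟨ ι-◃ (sign i Sign.* sign j) (∣ i ∣ ℕ.* ∣ j ∣) ⟩
    σ (sign i Sign.* sign j) * ((∣ i ∣ ℕ.* ∣ j ∣) ×ᴿ 1#)    ≈⟨ *-cong (σ-* (sign i) (sign j)) (×1-homo-* ∣ i ∣ ∣ j ∣) ⟩
    (σ (sign i) * σ (sign j)) * (∣ i ∣ ×ᴿ 1# * ∣ j ∣ ×ᴿ 1#)  ≈⟨ interchange _ _ _ _ ⟩
    σ (sign i) * ∣ i ∣ ×ᴿ 1# * (σ (sign j) * ∣ j ∣ ×ᴿ 1#)    ≈⟨ *-cong (ι-sign-abs i) (ι-sign-abs j) ⟨
    ι i * ι j                                              ∎

  ι-neg : ∀ i → ι (ℤ.- i) ≈ - ι i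
  ι-neg (+ zero)  = sym -0#≈0#
  ι-neg (+ suc n) = refl
  ι-neg -[1+ n ]  = sym (-‿involutive _)

  ι-homomorphism : ℤ.+-*-rawRing -Raw-AlmostCommutative⟶ fromCommutativeRing R
  ι-homomorphism = record
    { ⟦_⟧    = ι
    ; +-homo = ι-+
    ; *-homo = ι-*
    ; -‿homo = ι-neg
    ; 0-homo = refl
    ; 1-homo = +-identityʳ 1#
    }

  ι-≟ : ∀ i j → Maybe (ι i ≈ ι j)
  ι-≟ i j = map (λ { ≡.refl → refl }) (dec⇒weaklyDec ℤ._≟_ i j)

  open import Algebra.Solver.Ring ℤ.+-*-rawRing (fromCommutativeRing R) ι-homomorphism ι-≟ public

  -- Polynomials up to equality of their evaluations. Instantiating the matrix operations at
  -- this ring turns every matrix identity below into four polynomial identities.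
  Polynomials : ℕ → CommutativeRing 0ℓ (c ⊔ ℓ)
  Polynomials n = record
    { Carrier           = Polynomial n
    ; _≈_               = λ p q → ∀ ρ → ⟦ p ⟧ ρ ≈ ⟦ q ⟧ ρ
    ; _+_               = _:+_
    ; _*_               = _:*_
    ; -_                = :-_
    ; 0#                = con (+ 0)
    ; 1#                = con (+ 1)
    ; isCommutativeRing = record
      { isRing = record
        { +-isAbelianGroup = record
          { isGroup = record
            { isMonoid = record
              { isSemigroup = record
                { isMagma = record
                  { isEquivalence = record
                    { refl  = λ _ → refl
                    ; sym   = λ p≈q ρ → sym (p≈q ρ)
                    ; trans = λ p≈q q≈r ρ → trans (p≈q ρ) (q≈r ρ)
                    }
                  ; ∙-cong = λ p≈q r≈s ρ → +-cong (p≈q ρ) (r≈s ρ)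
                  }
                ; assoc = λ p q r ρ → +-assoc _ _ _
                }
              ; identity = (λ p ρ → +-identityˡ _) , (λ p ρ → +-identityʳ _)
              }
            ; inverse = (λ p ρ → -‿inverseˡ _) , (λ p ρ → -‿inverseʳ _)
            ; ⁻¹-cong = λ p≈q ρ → -‿cong (p≈q ρ)
            }
          ; comm = λ p q ρ → +-comm _ _
          }
        ; *-cong     = λ p≈q r≈s ρ → *-cong (p≈q ρ) (r≈s ρ)
        ; *-assoc    = λ p q r ρ → *-assoc _ _ _
        ; *-identity = (λ p ρ → trans (*-congʳ (+-identityʳ 1#)) (*-identityˡ _))
                     , (λ p ρ → trans (*-congˡ (+-identityʳ 1#)) (*-identityʳ _))
        ; distrib    = (λ p q r ρ → distribˡ _ _ _) , (λ p q r ρ → distribʳ _ _ _)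
        }
      ; *-comm = λ p q ρ → *-comm _ _
      }
    }

module Matrices {c ℓ : Level} (R : CommutativeRing c ℓ) where
  open CommutativeRing R

  infixl 7 _*M_
  infixl 6 _+M_
  infix  8 -M_
  infixr 8 _·M_
  infix  4 _≈M_

  _*M_ : M2 R → M2 R → M2 R
  _*M_ = D._*M_ R

  _+M_ : M2 R → M2 R → M2 R
  _+M_ = D._+M_ R

  _·M_ : Carrier → M2 R → M2 R
  _·M_ = D._·M_ R

  -M_ : M2 R → M2 R
  -M_ = D.-M_ R

  adj : M2 R → M2 R
  adj = D.adj R

  nrd : M2 R → Carrier
  nrd = D.nrd R

  _≈M_ : M2 R → M2 R → Set ℓ
  A ≈M B = M2.a A ≈ M2.a B × M2.b A ≈ M2.b B × M2.c' A ≈ M2.c' B × M2.d A ≈ M2.d B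

  ≈M-sym : ∀ {A B} → A ≈M B → B ≈M A
  ≈M-sym (a , b , c' , d) = sym a , sym b , sym c' , sym d

  ≈M-trans : ∀ {A B C} → A ≈M B → B ≈M C → A ≈M C
  ≈M-trans (a , b , c' , d) (a′ , b′ , c″ , d′) = trans a a′ , trans b b′ , trans c' c″ , trans d d′

  ·M-identity≈ : ∀ {k} A → k ≈ 1# → k ·M A ≈M A
  ·M-identity≈ A k≈1 = one (M2.a A) , one (M2.b A) , one (M2.c' A) , one (M2.d A)
    where
    one : ∀ x → _ * x ≈ x
    one x = trans (*-congʳ k≈1) (*-identityˡ x)

  entry : M2 R → Fin 2 → Fin 2 → Carrier
  entry M zero       zero       = M2.a M
  entry M zero       (suc zero) = M2.b M
  entry M (suc zero) zero       = M2.c' M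
  entry M (suc zero) (suc zero) = M2.d M

  Vector : Set c
  Vector = Carrier × Carrier

  infixr 8 _·V_
  _·V_ : Carrier → Vector → Vector
  u ·V (x , y) = u * x , u * y

  basis : Fin 2 → Vector
  basis zero       = 1# , 0#
  basis (suc zero) = 0# , 1#

  perp : Vector → Vector
  perp (x , y) = - y , x

  outer : Vector → Vector → M2 R
  outer (s , t) (x , y) = mat (s * x) (s * y) (t * x) (t * y)

  form : Vector → M2 R → Vector → Carrier
  form (s , t) (mat a b c' d) (x , y) = s * (a * x + b * y) + t * (c' * x + d * y)

  private
    1p+0q≈p : ∀ p q → 1# * p + 0# * q ≈ p
    1p+0q≈p p q = trans (+-cong (*-identityˡ p) (zeroˡ q)) (+-identityʳ p)
    0p+1q≈q : ∀ p q → 0# * p + 1# * q ≈ q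
    0p+1q≈q p q = trans (+-cong (zeroˡ p) (*-identityˡ q)) (+-identityˡ q)
    p1+q0≈p : ∀ p q → p * 1# + q * 0# ≈ p
    p1+q0≈p p q = trans (+-cong (*-identityʳ p) (zeroʳ q)) (+-identityʳ p)
    p0+q1≈q : ∀ p q → p * 0# + q * 1# ≈ q
    p0+q1≈q p q = trans (+-cong (zeroʳ p) (*-identityʳ q)) (+-identityˡ q)

  form-basis : ∀ M i j → form (basis i) M (basis j) ≈ entry M i j
  form-basis M zero       zero       = trans (1p+0q≈p _ _) (p1+q0≈p _ _)
  form-basis M zero       (suc zero) = trans (1p+0q≈p _ _) (p0+q1≈q _ _)
  form-basis M (suc zero) zero       = trans (0p+1q≈q _ _) (p1+q0≈p _ _)
  form-basis M (suc zero) (suc zero) = trans (0p+1q≈q _ _) (p0+q1≈q _ _)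

  sandwich : M2 R → M2 R → M2 R
  sandwich η A = adj η *M A *M η

  generator : Vector → M2 R
  generator w = outer (perp w) w

  coordinate : M2 R → Vector → M2 R → Carrier
  coordinate η z A = form (perp z) (sandwich η A) z

  -- The multiple of nrd η in sandwich-division below: expand (e η†) A (e η) using
  -- e η† = η† X η† + nrd η · adj X  and  e η = η Z η + nrd η · adj Z,  where e = wᵀ η z.
  remainder : M2 R → M2 R → Vector → Vector → M2 R
  remainder η A w z = adj η *M X *M adj η *M A *M adj Z +M form w η z ·M (adj X *M A *M η)
    where
    X = outer (perp w) (perp z)
    Z = outer z w

module MatrixIdentities {c ℓ : Level} (R : CommutativeRing c ℓ) where
  open CommutativeRing R
  open IntegerCoefficients R
  open Matrices R
  module P {n : ℕ} = Matrices (Polynomials n)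

  evalM : ∀ {n} → M2 (Polynomials n) → Env n → M2 R
  evalM (mat a b c' d) ρ = mat (⟦ a ⟧ ρ) (⟦ b ⟧ ρ) (⟦ c' ⟧ ρ) (⟦ d ⟧ ρ)

  proveM : ∀ {n} (ρ : Env n) (A B : M2 (Polynomials n)) →
           ⟦ M2.a A ⟧↓ ρ ≈ ⟦ M2.a B ⟧↓ ρ × ⟦ M2.b A ⟧↓ ρ ≈ ⟦ M2.b B ⟧↓ ρ ×
           ⟦ M2.c' A ⟧↓ ρ ≈ ⟦ M2.c' B ⟧↓ ρ × ⟦ M2.d A ⟧↓ ρ ≈ ⟦ M2.d B ⟧↓ ρ →
           evalM A ρ ≈M evalM B ρ
  proveM ρ A B (a , b , c' , d) =
    prove ρ (M2.a A) (M2.a B) a , prove ρ (M2.b A) (M2.b B) b ,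
    prove ρ (M2.c' A) (M2.c' B) c' , prove ρ (M2.d A) (M2.d B) d

  sandwich-division : ∀ η A w z → let e = form w η z in
    (e * e) ·M sandwich η A ≈M
      sandwich η (coordinate η z A ·M generator w) +M nrd η ·M remainder η A w z
  sandwich-division (mat a b c' d) (mat p q r s) (w₁ , w₂) (z₁ , z₂) =
    proveM ρ ((e :* e) P.·M P.sandwich η A)
             (P.sandwich η (P.coordinate η z A P.·M P.generator w) P.+M P.nrd η P.·M P.remainder η A w z)
           (refl , refl , refl , refl)
    where
    ρ = a ∷ b ∷ c' ∷ d ∷ p ∷ q ∷ r ∷ s ∷ w₁ ∷ w₂ ∷ z₁ ∷ z₂ ∷ []
    η = mat (var (# 0)) (var (# 1)) (var (# 2)) (var (# 3))
    A = mat (var (# 4)) (var (# 5)) (var (# 6)) (var (# 7))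
    w = var (# 8) , var (# 9)
    z = var (# 10) , var (# 11)
    e = P.form w η z

  sandwich-·M : ∀ η x A → sandwich η (x ·M A) ≈M x ·M sandwich η A
  sandwich-·M (mat a b c' d) x (mat p q r s) =
    proveM ρ (P.sandwich η (var (# 4) P.·M A)) (var (# 4) P.·M P.sandwich η A) (refl , refl , refl , refl)
    where
    ρ = a ∷ b ∷ c' ∷ d ∷ x ∷ p ∷ q ∷ r ∷ s ∷ []
    η = mat (var (# 0)) (var (# 1)) (var (# 2)) (var (# 3))
    A = mat (var (# 5)) (var (# 6)) (var (# 7)) (var (# 8))

  coordinate-generator : ∀ η w z x → coordinate η z (x ·M generator w) ≈ x * (form w η z * form w η z)
  coordinate-generator (mat a b c' d) (w₁ , w₂) (z₁ , z₂) x =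
    solve 9 (λ a b c' d w₁ w₂ z₁ z₂ x → let η = mat a b c' d; w = w₁ , w₂; z = z₁ , z₂ in
               P.coordinate η z (x P.·M P.generator w) := x :* (P.form w η z :* P.form w η z))
            refl a b c' d w₁ w₂ z₁ z₂ x

  coordinate-+M : ∀ η z A B → coordinate η z (A +M B) ≈ coordinate η z A + coordinate η z B
  coordinate-+M (mat a b c' d) (z₁ , z₂) (mat p q r s) (mat p′ q′ r′ s′) =
    solve 14 (λ a b c' d z₁ z₂ p q r s p′ q′ r′ s′ →
                let η = mat a b c' d; z = z₁ , z₂; A = mat p q r s; B = mat p′ q′ r′ s′ in
                P.coordinate η z (A P.+M B) := P.coordinate η z A :+ P.coordinate η z B)
             refl a b c' d z₁ z₂ p q r s p′ q′ r′ s′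

  coordinate-·M : ∀ η z x A → coordinate η z (x ·M A) ≈ x * coordinate η z A
  coordinate-·M (mat a b c' d) (z₁ , z₂) x (mat p q r s) =
    solve 11 (λ a b c' d z₁ z₂ x p q r s →
                let η = mat a b c' d; z = z₁ , z₂; A = mat p q r s in
                P.coordinate η z (x P.·M A) := x :* P.coordinate η z A)
             refl a b c' d z₁ z₂ x p q r s

  form-·V : ∀ u w M z → form (u ·V w) M z ≈ u * form w M z
  form-·V u (w₁ , w₂) (mat a b c' d) (z₁ , z₂) =
    solve 9 (λ u w₁ w₂ a b c' d z₁ z₂ → let w = w₁ , w₂; M = mat a b c' d; z = z₁ , z₂ in
               P.form (u P.·V w) M z := u :* P.form w M z)
            refl u w₁ w₂ a b c' d z₁ z₂

≤∞-trans : ∀ {p q r} → p ≤∞ q → q ≤∞ r → p ≤∞ r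
≤∞-trans {fin _} {fin _} {fin _} p≤q q≤r = ℤ.≤-trans p≤q q≤r
≤∞-trans {fin _} {fin _} {∞}     _   _   = tt
≤∞-trans {fin _} {∞}     {∞}     _   _   = tt
≤∞-trans {∞}     {∞}     {∞}     _   _   = tt

⊓∞-greatest : ∀ {r p q} → r ≤∞ p → r ≤∞ q → r ≤∞ (p ⊓∞ q)
⊓∞-greatest {fin _} {fin _} {fin _} r≤p r≤q = ℤ.⊓-glb r≤p r≤q
⊓∞-greatest {fin _} {fin _} {∞}     r≤p _   = r≤p
⊓∞-greatest {_}     {∞}     {_}     _   r≤q = r≤q

+∞-nonNegative : ∀ {p q} → fin (+ 0) ≤∞ p → fin (+ 0) ≤∞ q → fin (+ 0) ≤∞ (p +∞ q)
+∞-nonNegative {fin _} {fin _} 0≤p 0≤q = ℤ.+-mono-≤ 0≤p 0≤q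
+∞-nonNegative {fin _} {∞}     _   _   = tt
+∞-nonNegative {∞}     {_}     _   _   = tt

fin-injective : ∀ {i j} → fin i ≡ fin j → i ≡ j
fin-injective ≡.refl = ≡.refl

module Integrality {c ℓ : Level} {R : CommutativeRing c ℓ} (L : NALocalField R) where
  open CommutativeRing R hiding (zero)
  open NALocalField L
  open LF L
  open Matrices R
  open import Algebra.Properties.Ring ring using (-1*x≈-x; -‿involutive)
  open import Algebra.Properties.CommutativeSemigroup *-commutativeSemigroup using (x∙yz≈y∙xz)
  open import Algebra.Properties.Group (AbelianGroup.group ℤ.+-0-abelianGroup)
    using (identityˡ-unique; inverseʳ-unique)
  open import Relation.Binary.Reasoning.Setoid setoid

  v-1# : v 1# ≡ fin (+ 0)
  v-1# with v 1# | ≡.trans (≡.sym (v-mul 1# 1#)) (v-cong (*-identityˡ 1#)) | proj₁ (v-zero 1#)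
  ... | fin k | k+k≡k | _   = ≡.cong fin (identityˡ-unique k k (fin-injective k+k≡k))
  ... | ∞     | _     | 1≈0 = ⊥-elim (proj₁ isField (1≈0 ≡.refl))

  v-inverse : ∀ {x y k} → x * y ≈ 1# → v x ≡ fin k → v y ≡ fin (ℤ.- k)
  v-inverse {x} {y} {k} xy≈1 vx≡k with v y | ≡.trans (≡.sym (v-mul x y)) (≡.trans (v-cong xy≈1) v-1#)
  ... | fin j | vx+j≡0 rewrite vx≡k = ≡.cong fin (inverseʳ-unique k j (fin-injective vx+j≡0))
  ... | ∞     | vx+∞≡0 rewrite vx≡k = case vx+∞≡0 of λ ()

  v-fin⇒≉0 : ∀ {x k} → v x ≡ fin k → ¬ x ≈ 0#
  v-fin⇒≉0 {x} vx≡k x≈0 = case ≡.trans (≡.sym vx≡k) (proj₂ (v-zero x) x≈0) of λ ()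

  Integral-resp : ∀ {x y} → x ≈ y → Integral x → Integral y
  Integral-resp x≈y (_ , 0≤vx) = _ , ≡.subst (fin (+ 0) ≤∞_) (v-cong x≈y) 0≤vx

  Integral-0# : Integral 0#
  Integral-0# = _ , ≡.subst (fin (+ 0) ≤∞_) (≡.sym (proj₂ (v-zero 0#) refl)) tt

  Integral-1# : Integral 1#
  Integral-1# = _ , ≡.subst (fin (+ 0) ≤∞_) (≡.sym v-1#) ℤ.≤-refl

  Integral-+ : ∀ {x y} → Integral x → Integral y → Integral (x + y)
  Integral-+ {x} {y} (_ , 0≤vx) (_ , 0≤vy) = _ , ≤∞-trans (⊓∞-greatest 0≤vx 0≤vy) (v-add x y)

  Integral-* : ∀ {x y} → Integral x → Integral y → Integral (x * y)
  Integral-* {x} {y} (_ , 0≤vx) (_ , 0≤vy) =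
    _ , ≡.subst (fin (+ 0) ≤∞_) (≡.sym (v-mul x y)) (+∞-nonNegative 0≤vx 0≤vy)

  Integral-[-1#] : Integral (- 1#)
  Integral-[-1#] = _ , nonNegative (v (- 1#)) (≡.trans (≡.sym (v-mul (- 1#) (- 1#))) (≡.trans (v-cong -1*-1≈1) v-1#))
    where
    -1*-1≈1 : - 1# * - 1# ≈ 1#
    -1*-1≈1 = trans (-1*x≈-x (- 1#)) (-‿involutive 1#)
    nonNegative : ∀ t → t +∞ t ≡ fin (+ 0) → fin (+ 0) ≤∞ t
    nonNegative (fin (+ _))    _ = ℤ.+≤+ z≤n
    nonNegative (fin -[1+ _ ]) ()
    nonNegative ∞              ()

  Integral-neg : ∀ {x} → Integral x → Integral (- x)
  Integral-neg {x} x-int = Integral-resp (-1*x≈-x x) (Integral-* Integral-[-1#] x-int)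

  Unit : Carrier → Set (c ⊔ ℓ)
  Unit x = ∃[ u ] (Integral u × x * u ≈ 1#)

  Unit-resp : ∀ {x y} → x ≈ y → Unit x → Unit y
  Unit-resp x≈y (u , u-int , xu≈1) = u , u-int , trans (*-congʳ (sym x≈y)) xu≈1

  valuation-0⇒Unit : ∀ {x} → v x ≡ fin (+ 0) → Unit x
  valuation-0⇒Unit {x} vx≡0 = u , (_ , ≡.subst (fin (+ 0) ≤∞_) (≡.sym (v-inverse xu≈1 vx≡0)) ℤ.≤-refl) , xu≈1
    where
    u = proj₁ (proj₂ isField x (v-fin⇒≉0 vx≡0))
    xu≈1 = proj₂ (proj₂ isField x (v-fin⇒≉0 vx≡0))

  ϖ⁻¹ : Carrier
  ϖ⁻¹ = proj₁ (proj₂ isField ϖ (v-fin⇒≉0 v-ϖ))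

  ϖϖ⁻¹≈1 : ϖ * ϖ⁻¹ ≈ 1#
  ϖϖ⁻¹≈1 = proj₂ (proj₂ isField ϖ (v-fin⇒≉0 v-ϖ))

  positive-valuation⇒ϖ∣ : ∀ {x k} → v x ≡ fin (+ suc k) → ϖ ∣O x
  positive-valuation⇒ϖ∣ {x} vx≡1+k = x * ϖ⁻¹ , (_ , 0≤v[xϖ⁻¹]) , (begin
    x                ≈⟨ *-identityʳ x ⟨
    x * 1#           ≈⟨ *-congˡ ϖϖ⁻¹≈1 ⟨
    x * (ϖ * ϖ⁻¹)    ≈⟨ x∙yz≈y∙xz x ϖ ϖ⁻¹ ⟩
    ϖ * (x * ϖ⁻¹)    ∎)
    where
    0≤v[xϖ⁻¹] : fin (+ 0) ≤∞ v (x * ϖ⁻¹)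
    0≤v[xϖ⁻¹] = ≡.subst (fin (+ 0) ≤∞_)
      (≡.sym (≡.trans (v-mul x ϖ⁻¹) (≡.cong₂ _+∞_ vx≡1+k (v-inverse ϖϖ⁻¹≈1 v-ϖ)))) (ℤ.+≤+ z≤n)

  Unit⊎ϖ∣ : ∀ {x} → Integral x → Unit x ⊎ ϖ ∣O x
  Unit⊎ϖ∣ {x} (_ , 0≤vx) with v x in vx≡
  ... | fin (+ zero)  = inj₁ (valuation-0⇒Unit vx≡)
  ... | fin (+ suc k) = inj₂ (positive-valuation⇒ϖ∣ vx≡)
  ... | fin -[1+ k ]  = ⊥-elim (ℤ.<⇒≱ ℤ.-<+ 0≤vx)
  ... | ∞             = inj₂ (0# , Integral-0# , trans (proj₁ (v-zero x) vx≡) (sym (zeroʳ ϖ)))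

  IntegralV : Vector → Set (c ⊔ ℓ)
  IntegralV (x , y) = Integral x × Integral y

  Integral-form : ∀ {s M z} → IntegralV s → IntegralM M → IntegralV z → Integral (form s M z)
  Integral-form (s , t) (a , b , c' , d) (x , y) =
    Integral-+ (Integral-* s (Integral-+ (Integral-* a x) (Integral-* b y)))
               (Integral-* t (Integral-+ (Integral-* c' x) (Integral-* d y)))

  IntegralV-basis : ∀ i → IntegralV (basis i)
  IntegralV-basis zero       = Integral-1# , Integral-0#
  IntegralV-basis (suc zero) = Integral-0# , Integral-1#

  IntegralV-·V : ∀ {u w} → Integral u → IntegralV w → IntegralV (u ·V w)
  IntegralV-·V u (x , y) = Integral-* u x , Integral-* u y

  IntegralV-perp : ∀ {w} → IntegralV w → IntegralV (perp w)
  IntegralV-perp (x , y) = Integral-neg y , x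

  IntegralM-outer : ∀ {s w} → IntegralV s → IntegralV w → IntegralM (outer s w)
  IntegralM-outer (s , t) (x , y) = Integral-* s x , Integral-* s y , Integral-* t x , Integral-* t y

  IntegralM-+M : ∀ {A B} → IntegralM A → IntegralM B → IntegralM (A +M B)
  IntegralM-+M (a , b , c' , d) (a′ , b′ , c″ , d′) =
    Integral-+ a a′ , Integral-+ b b′ , Integral-+ c' c″ , Integral-+ d d′

  IntegralM-*M : ∀ {A B} → IntegralM A → IntegralM B → IntegralM (A *M B)
  IntegralM-*M (a , b , c' , d) (a′ , b′ , c″ , d′) =
    Integral-+ (Integral-* a a′) (Integral-* b c″) , Integral-+ (Integral-* a b′) (Integral-* b d′) ,
    Integral-+ (Integral-* c' a′) (Integral-* d c″) , Integral-+ (Integral-* c' b′) (Integral-* d d′)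

  IntegralM-·M : ∀ {x A} → Integral x → IntegralM A → IntegralM (x ·M A)
  IntegralM-·M x (a , b , c' , d) = Integral-* x a , Integral-* x b , Integral-* x c' , Integral-* x d

  IntegralM-adj : ∀ {A} → IntegralM A → IntegralM (adj A)
  IntegralM-adj (a , b , c' , d) = d , Integral-neg b , Integral-neg c' , a

  IntegralM-sandwich : ∀ {η A} → IntegralM η → IntegralM A → IntegralM (sandwich η A)
  IntegralM-sandwich η A = IntegralM-*M (IntegralM-*M (IntegralM-adj η) A) η

  IntegralM-remainder : ∀ {η A w z} → IntegralM η → IntegralM A → IntegralV w → IntegralV z →
                        IntegralM (remainder η A w z)
  IntegralM-remainder η A w z =
    IntegralM-+M (IntegralM-*M (IntegralM-*M (IntegralM-*M (IntegralM-*M η† X) η†) A) (IntegralM-adj Z))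
                 (IntegralM-·M (Integral-form w η z) (IntegralM-*M (IntegralM-*M (IntegralM-adj X) A) η))
    where
    η† = IntegralM-adj η
    X = IntegralM-outer (IntegralV-perp w) (IntegralV-perp z)
    Z = IntegralM-outer z w

  primitive⇒unit-entry : ∀ {η} → IntegralM η → ¬ ϖ ∣OD η → ∃[ i ] ∃[ j ] Unit (entry η i j)
  primitive⇒unit-entry (a , b , c' , d) ¬ϖ∣η with Unit⊎ϖ∣ a | Unit⊎ϖ∣ b | Unit⊎ϖ∣ c' | Unit⊎ϖ∣ d
  ... | inj₁ a-unit | _           | _            | _           = zero , zero , a-unit
  ... | inj₂ _      | inj₁ b-unit | _            | _           = zero , suc zero , b-unit
  ... | inj₂ _      | inj₂ _      | inj₁ c-unit  | _           = suc zero , zero , c-unit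
  ... | inj₂ _      | inj₂ _      | inj₂ _       | inj₁ d-unit = suc zero , suc zero , d-unit
  ... | inj₂ ϖ∣a    | inj₂ ϖ∣b    | inj₂ ϖ∣c     | inj₂ ϖ∣d    = ⊥-elim (¬ϖ∣η (ϖ∣a , ϖ∣b , ϖ∣c , ϖ∣d))

module Congruence {c ℓ : Level} {R : CommutativeRing c ℓ} (L : NALocalField R) where
  open CommutativeRing R
  open LF L
  open Matrices R
  open Integrality L
  open IntegerCoefficients R using (solve; _:=_; _:+_; _:*_; :-_)
  open import Algebra.Properties.Ring ring using (-‿distribʳ-*)
  open import Algebra.Properties.AbelianGroup +-abelianGroup using (⁻¹-anti-homo‿-)
  open import Algebra.Properties.CommutativeSemigroup *-commutativeSemigroup using (x∙yz≈y∙xz)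
  open import Relation.Binary.Reasoning.Setoid setoid

  -- Defs' A ≈[ η ]S B unfolds to sandwich η A ≋[ nrd η ] sandwich η B.
  infix 4 _≋[_]_
  _≋[_]_ : M2 R → Carrier → M2 R → Set (c ⊔ ℓ)
  A ≋[ t ] B = t ∣OD (A +M -M B)

  module _ {t : Carrier} where

    ≈Q-reflexive : ∀ {x y} → x ≈ y → x ≈[ t ]Q y
    ≈Q-reflexive {x} {y} x≈y = 0# , Integral-0# , (begin
      x + - y  ≈⟨ +-congʳ x≈y ⟩
      y + - y  ≈⟨ -‿inverseʳ y ⟩
      0#       ≈⟨ zeroʳ t ⟨
      t * 0#   ∎)

    ≈Q-sym : ∀ {x y} → x ≈[ t ]Q y → y ≈[ t ]Q x
    ≈Q-sym {x} {y} (q , q-int , x-y≈tq) = - q , Integral-neg q-int , (begin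
      y + - x      ≈⟨ ⁻¹-anti-homo‿- x y ⟨
      - (x + - y)  ≈⟨ -‿cong x-y≈tq ⟩
      - (t * q)    ≈⟨ -‿distribʳ-* t q ⟩
      t * - q      ∎)

    ≈Q-resp : ∀ {x x′ y y′} → x ≈ x′ → y ≈ y′ → x ≈[ t ]Q y → x′ ≈[ t ]Q y′
    ≈Q-resp x≈x′ y≈y′ (q , q-int , x-y≈tq) = q , q-int , trans (+-cong (sym x≈x′) (-‿cong (sym y≈y′))) x-y≈tq

    ≈Q-intro : ∀ {x y q} → Integral q → x ≈ y + t * q → x ≈[ t ]Q y
    ≈Q-intro {x} {y} {q} q-int x≈y+tq = q , q-int , (begin
      x + - y          ≈⟨ +-congʳ x≈y+tq ⟩
      y + t * q + - y  ≈⟨ solve 3 (λ y t q → y :+ t :* q :+ :- y := t :* q) refl y t q ⟩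
      t * q            ∎)

    ≈Q-+ : ∀ {x x′ y y′} → x ≈[ t ]Q x′ → y ≈[ t ]Q y′ → (x + y) ≈[ t ]Q (x′ + y′)
    ≈Q-+ {x} {x′} {y} {y′} (q , q-int , x-x′≈tq) (r , r-int , y-y′≈tr) = q + r , Integral-+ q-int r-int , (begin
      x + y + - (x′ + y′)      ≈⟨ solve 4 (λ x x′ y y′ → x :+ y :+ :- (x′ :+ y′) := x :+ :- x′ :+ (y :+ :- y′))
                                          refl x x′ y y′ ⟩
      x + - x′ + (y + - y′)    ≈⟨ +-cong x-x′≈tq y-y′≈tr ⟩
      t * q + t * r            ≈⟨ distribˡ t q r ⟨
      t * (q + r)              ∎)

    ≈Q-*ˡ : ∀ {k x y} → Integral k → x ≈[ t ]Q y → (k * x) ≈[ t ]Q (k * y)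
    ≈Q-*ˡ {k} {x} {y} k-int (q , q-int , x-y≈tq) = k * q , Integral-* k-int q-int , (begin
      k * x + - (k * y)  ≈⟨ solve 3 (λ k x y → k :* x :+ :- (k :* y) := k :* (x :+ :- y)) refl k x y ⟩
      k * (x + - y)      ≈⟨ *-congˡ x-y≈tq ⟩
      k * (t * q)        ≈⟨ x∙yz≈y∙xz k t q ⟩
      t * (k * q)        ∎)

    ≈Q-*ʳ : ∀ {k x y} → Integral k → x ≈[ t ]Q y → (x * k) ≈[ t ]Q (y * k)
    ≈Q-*ʳ k-int x≈y = ≈Q-resp (*-comm _ _) (*-comm _ _) (≈Q-*ˡ k-int x≈y)

    ≋-sym : ∀ {A B} → A ≋[ t ] B → B ≋[ t ] A
    ≋-sym (a , b , c' , d) = ≈Q-sym a , ≈Q-sym b , ≈Q-sym c' , ≈Q-sym d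

    ≋-resp : ∀ {A A′ B B′} → A ≈M A′ → B ≈M B′ → A ≋[ t ] B → A′ ≋[ t ] B′
    ≋-resp (a , b , c' , d) (a′ , b′ , c″ , d′) (a≋ , b≋ , c≋ , d≋) =
      ≈Q-resp a a′ a≋ , ≈Q-resp b b′ b≋ , ≈Q-resp c' c″ c≋ , ≈Q-resp d d′ d≋

    ≋-intro : ∀ {A B Y} → IntegralM Y → A ≈M B +M t ·M Y → A ≋[ t ] B
    ≋-intro (a , b , c' , d) (a≈ , b≈ , c≈ , d≈) =
      ≈Q-intro a a≈ , ≈Q-intro b b≈ , ≈Q-intro c' c≈ , ≈Q-intro d d≈

    ≋-·M : ∀ {x y A} → x ≈[ t ]Q y → IntegralM A → x ·M A ≋[ t ] y ·M A
    ≋-·M x≈y (a , b , c' , d) = ≈Q-*ʳ a x≈y , ≈Q-*ʳ b x≈y , ≈Q-*ʳ c' x≈y , ≈Q-*ʳ d x≈y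

    form-≋ : ∀ {s A B z} → IntegralV s → IntegralV z → A ≋[ t ] B → form s A z ≈[ t ]Q form s B z
    form-≋ (s₁ , s₂) (z₁ , z₂) (a , b , c' , d) =
      ≈Q-+ (≈Q-*ˡ s₁ (≈Q-+ (≈Q-*ʳ z₁ a) (≈Q-*ʳ z₂ b))) (≈Q-*ˡ s₂ (≈Q-+ (≈Q-*ʳ z₁ c') (≈Q-*ʳ z₂ d)))

module Isomorphism {c ℓ : Level} {R : CommutativeRing c ℓ} (L : NALocalField R) where
  open CommutativeRing R
  open LF L
  open Matrices R
  open MatrixIdentities R
    using (sandwich-division; sandwich-·M; coordinate-generator; coordinate-+M; coordinate-·M; form-·V)
  open Integrality L
  open Congruence L

  module _ {η : M2 R} (η-int : IntegralM η) {w z : Vector} (w-int : IntegralV w) (z-int : IntegralV z)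
           (e≈1 : form w η z ≈ 1#) where

    private
      e²≈1 : form w η z * form w η z ≈ 1#
      e²≈1 = trans (*-cong e≈1 e≈1) (*-identityˡ 1#)

      IntegralM-generator : IntegralM (generator w)
      IntegralM-generator = IntegralM-outer (IntegralV-perp w-int) w-int

      Integral-coordinate : ∀ {A} → IntegralM A → Integral (coordinate η z A)
      Integral-coordinate A-int = Integral-form (IntegralV-perp z-int) (IntegralM-sandwich η-int A-int) z-int

    sandwich≋coordinate·generator : ∀ {A} → IntegralM A →
      sandwich η A ≋[ nrd η ] sandwich η (coordinate η z A ·M generator w)
    sandwich≋coordinate·generator {A} A-int =
      ≋-intro (IntegralM-remainder η-int A-int w-int z-int)
              (≈M-trans (≈M-sym (·M-identity≈ (sandwich η A) e²≈1)) (sandwich-division η A w z))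

    normalised-modIso : ModIso η
    normalised-modIso = record
      { to        = λ A _ → coordinate η z A
      ; to-int    = λ _ A-int → Integral-coordinate A-int
      ; from      = λ x _ → x ·M generator w
      ; from-int  = λ _ x-int → IntegralM-·M x-int IntegralM-generator
      ; to-cong   = λ _ _ _ _ → form-≋ (IntegralV-perp z-int) z-int
      ; from-cong = λ x _ y _ x≈y →
          ≋-resp (≈M-sym (sandwich-·M η x (generator w))) (≈M-sym (sandwich-·M η y (generator w)))
                 (≋-·M x≈y (IntegralM-sandwich η-int IntegralM-generator))
      ; from∘to   = λ _ A-int → ≋-sym (sandwich≋coordinate·generator A-int)
      ; to∘from   = λ x _ → ≈Q-reflexive (trans (coordinate-generator η w z x) (trans (*-congˡ e²≈1) (*-identityʳ x)))
      ; to-+      = λ A _ B _ _ → ≈Q-reflexive (coordinate-+M η z A B)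
      ; to-·      = λ x _ A _ _ → ≈Q-reflexive (coordinate-·M η z x A)
      }

    normalised-cyclic : Cyclic η
    normalised-cyclic = generator w , IntegralM-generator ,
      λ A A-int → coordinate η z A , Integral-coordinate A-int , sandwich≋coordinate·generator A-int

  unit-form⇒modIso×cyclic : ∀ {η w z} → IntegralM η → IntegralV w → IntegralV z → Unit (form w η z) →
                            ModIso η × Cyclic η
  unit-form⇒modIso×cyclic {η} {w} {z} η-int w-int z-int (u , u-int , eu≈1) =
    normalised-modIso η-int uw-int z-int ue≈1 , normalised-cyclic η-int uw-int z-int ue≈1
    where
    uw-int = IntegralV-·V u-int w-int
    ue≈1 = trans (form-·V u w η z) (trans (*-comm u _) eu≈1)

lemma8p1 : {c ℓ : Level} (R : CommutativeRing c ℓ) (L : NALocalField R)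
           (η : M2 R) → LF.IntegralM L η →
           ¬ LF._∣OD_ L (NALocalField.ϖ L) η →
           LF.ModIso L η × LF.Cyclic L η
lemma8p1 R L η η-int η-primitive =
  let i , j , unit = primitive⇒unit-entry η-int η-primitive in
  unit-form⇒modIso×cyclic η-int (IntegralV-basis i) (IntegralV-basis j) (Unit-resp (sym (form-basis η i j)) unit)
  where
  open CommutativeRing R using (sym)
  open Matrices R using (form-basis)
  open Integrality L
  open Isomorphism L
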